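{- Let $B\subset\mathbb{N}$ and let $\nu_1,\nu_2:\mathbb{N}\to\mathbb{R}$ be functions that are locally polynomial on $B$ of degree at most $k_1$ and $k_2$ respectively. Then $\nu_1+\nu_2$ is locally polynomial of degree at most $\max\{k_1,k_2\}$ on $B$, and the pointwise product $\nu_1\cdot\nu_2$ is locally polynomial of degree at most $k_1+k_2$ on $B$.
   Context: For a function $\phi$ write $\Delta_h\phi(n)=\phi(n+h)-\phi(n)$ and $\Delta_{h_1,\dots,h_j}=\Delta_{h_1}\cdots\Delta_{h_j}$. A function $\phi:\mathbb{N}\to\mathbb{R}$ is locally polynomial of degree (at most) $d$ on $B\subset\mathbb{N}$ if whenever $n\in\mathbb{Z}$ and $h\in\mathbb{Z}^{d+1}$ satisfy $n+\omega\cdot h\in B$ for all $\omega\in\{0,1\}^{d+1}$, we have $\Delta_{h_1,\dots,h_{d+1}}\phi(n)=0$. -}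

module Defs where

open import Level using (Level)
open import Data.Bool using (Bool; true; false)
open import Data.Empty using (⊥)
open import Data.Nat using (ℕ; zero; suc)
open import Data.Integer as ℤ using (ℤ; +_; -[1+_])
open import Data.Vec using (Vec; []; _∷_)
open import Algebra.Bundles using (CommutativeRing)

_·_ : ∀ {m} → Vec Bool m → Vec ℤ m → ℤ
[] · [] = + 0
(true ∷ ω) · (h ∷ hs) = h ℤ.+ (ω · hs)
(false ∷ ω) · (h ∷ hs) = ω · hs

_∈ℤ_ : ∀ {b} → ℤ → (ℕ → Set b) → Set b
(+ n) ∈ℤ B = B n
-[1+ n ] ∈ℤ B = Level.Lift _ ⊥

module _ {c ℓ} (R : CommutativeRing c ℓ) where
  open CommutativeRing R

  -- φ : ℕ → R viewed on ℤ; the values at negative integers are never used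
  -- in the definition below (all evaluation points lie in B ⊂ ℕ).
  ext : (ℕ → Carrier) → ℤ → Carrier
  ext φ (+ n) = φ n
  ext φ -[1+ n ] = 0#

  Δ : ℤ → (ℤ → Carrier) → ℤ → Carrier
  Δ h φ n = φ (n ℤ.+ h) - φ n

  Δs : ∀ {m} → Vec ℤ m → (ℤ → Carrier) → ℤ → Carrier
  Δs [] φ = φ
  Δs (h ∷ hs) φ = Δ h (Δs hs φ)

  LocallyPolynomial : ∀ {b} → (ℕ → Set b) → ℕ → (ℕ → Carrier) → Set _
  LocallyPolynomial B d φ =
    (n : ℤ) (h : Vec ℤ (suc d)) →
    ((ω : Vec Bool (suc d)) → (n ℤ.+ (ω · h)) ∈ℤ B) →
    Δs h (ext φ) n ≈ 0#

{-# OPTIONS --safe #-}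
-- Work on a single cube n + {0,1}^m · hs and track a bound on the degree there:
-- "degree < k" means that every difference of order at least k along distinct
-- directions of hs vanishes at every vertex of the cube spanned by the remaining
-- directions.  Local polynomiality of degree K gives degree < K + 1 on every cube in
-- B, and on a cube with exactly K + 1 directions degree < K + 1 is the vanishing of
-- the full difference.  Induction on the number of directions shows that these bounds
-- are preserved by sums, and that for products they add up (minus one) thanks to the
-- Leibniz rule Δₕ(fg) = Δₕf · g(· + h) + f · Δₕg.
module Submission where

open import Defs
open import Algebra.Bundles using (CommutativeRing)
open import Data.Bool using (Bool; true; false)
open import Data.Integer as ℤ using (ℤ; +_; -[1+_])
import Data.Integer.Properties as ℤP
open import Data.Integer.Tactic.RingSolver using (solve-∀)
open import Data.Maybe using (nothing)
open import Data.Nat using (ℕ; zero; suc; pred; _+_; _⊔_; _≤_; z≤n; s≤s)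
open import Data.Nat.Properties using (+-comm; +-suc; +-identityʳ; pred-mono-≤; m≤m⊔n; m≤n⊔m)
open import Data.Product using (_×_; _,_)
open import Data.Unit.Polymorphic using (⊤; tt)
open import Data.Vec using (Vec; []; _∷_)
open import Relation.Binary.PropositionalEquality as ≡ using (_≡_; subst)
open import Tactic.RingSolver.Core.AlmostCommutativeRing using (fromCommutativeRing)
open import Algebra.Properties.CommutativeSemigroup ℤP.+-commutativeSemigroup using (xy∙z≈xz∙y)

CubeIn : ∀ {b} → (ℕ → Set b) → ℤ → ∀ {m} → Vec ℤ m → Set b
CubeIn B n {m} hs = (ω : Vec Bool m) → (n ℤ.+ ω · hs) ∈ℤ B

-- The cube spanned by gs ++ hs, where gs collects the directions already differenced.
SplitCubeIn : ∀ {b} → (ℕ → Set b) → ℤ → ∀ {j m} → Vec ℤ j → Vec ℤ m → Set b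
SplitCubeIn B n gs hs = ∀ ω ω′ → (n ℤ.+ (ω · gs ℤ.+ ω′ · hs)) ∈ℤ B

module _ {c ℓ} (R : CommutativeRing c ℓ) where
  open CommutativeRing R
    using (Carrier; _≈_; 0#; _-_; refl; sym; trans; reflexive; +-cong; -‿cong; *-cong;
           +-assoc; +-identityˡ; -‿inverseˡ; -‿inverseʳ; zeroˡ; *-comm; -_; setoid)
    renaming (_+_ to _+ᴿ_; _*_ to _*ᴿ_)
  open import Tactic.RingSolver.NonReflective (fromCommutativeRing R (λ _ → nothing))
  open import Algebra.Properties.Ring (CommutativeRing.ring R) using (x[y-z]≈xy-xz; [y-z]x≈yx-zx)
  open import Relation.Binary.Reasoning.Setoid setoid

  _≗_ : (ℤ → Carrier) → (ℤ → Carrier) → Set ℓ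
  f ≗ g = ∀ x → f x ≈ g x

  Δ-cong : ∀ h {ψ χ} → ψ ≗ χ → Δ R h ψ ≗ Δ R h χ
  Δ-cong h ψ≗χ x = +-cong (ψ≗χ (x ℤ.+ h)) (-‿cong (ψ≗χ x))

  Δ-comm : ∀ h h′ χ → Δ R h′ (Δ R h χ) ≗ Δ R h (Δ R h′ χ)
  Δ-comm h h′ χ x = trans (swap _ _ _ _)
      (+-cong (+-cong (reflexive (≡.cong χ (xy∙z≈xz∙y x h′ h))) refl) refl)
    where
    swap : ∀ a b c d → (a - b) - (c - d) ≈ (a - c) - (b - d)
    swap = solve 4 (λ a b c d → ((a ⊕ ⊝ b) ⊕ ⊝ (c ⊕ ⊝ d)) ⊜ ((a ⊕ ⊝ c) ⊕ ⊝ (b ⊕ ⊝ d))) refl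

  Δs-Δ-comm : ∀ {m} (hs : Vec ℤ m) h ψ → Δs R hs (Δ R h ψ) ≗ Δ R h (Δs R hs ψ)
  Δs-Δ-comm []        h ψ x = refl
  Δs-Δ-comm (h′ ∷ hs) h ψ x =
    trans (Δ-cong h′ (Δs-Δ-comm hs h ψ) x) (Δ-comm h h′ (Δs R hs ψ) x)

  Δ-+ : ∀ h f g → Δ R h (λ x → f x +ᴿ g x) ≗ λ x → Δ R h f x +ᴿ Δ R h g x
  Δ-+ h f g x = interchange _ _ _ _
    where
    interchange : ∀ a b c d → (a +ᴿ b) - (c +ᴿ d) ≈ (a - c) +ᴿ (b - d)
    interchange = solve 4 (λ a b c d → ((a ⊕ b) ⊕ ⊝ (c ⊕ d)) ⊜ ((a ⊕ ⊝ c) ⊕ (b ⊕ ⊝ d))) refl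

  Δ-* : ∀ h f g → Δ R h (λ x → f x *ᴿ g x) ≗
                  λ x → Δ R h f x *ᴿ g (x ℤ.+ h) +ᴿ f x *ᴿ Δ R h g x
  Δ-* h f g x = leibniz _ _ _ _
    where
    telescope : ∀ a b c → (a - b) +ᴿ (b - c) ≈ a - c
    telescope a b c = begin
      (a - b) +ᴿ (b - c)   ≈⟨ +-assoc a (- b) (b - c) ⟩
      a +ᴿ (- b +ᴿ (b - c)) ≈⟨ +-cong refl (sym (+-assoc (- b) b (- c))) ⟩
      a +ᴿ ((- b +ᴿ b) - c) ≈⟨ +-cong refl (+-cong (-‿inverseˡ b) refl) ⟩
      a +ᴿ (0# - c)         ≈⟨ +-cong refl (+-identityˡ (- c)) ⟩
      a - c                 ∎

    leibniz : ∀ p q r s → p *ᴿ q - r *ᴿ s ≈ (p - r) *ᴿ q +ᴿ r *ᴿ (q - s)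
    leibniz p q r s = begin
      p *ᴿ q - r *ᴿ s                         ≈⟨ telescope _ (r *ᴿ q) _ ⟨
      (p *ᴿ q - r *ᴿ q) +ᴿ (r *ᴿ q - r *ᴿ s) ≈⟨ +-cong ([y-z]x≈yx-zx q p r) (x[y-z]≈xy-xz r q s) ⟨
      (p - r) *ᴿ q +ᴿ r *ᴿ (q - s)           ∎

  -- Each direction h is either frozen at 0, frozen at 1, or differenced (which
  -- lowers the bound); since pred 0 = 0, differences beyond order k must vanish as well.
  Deg< : ℕ → (ℤ → Carrier) → ℤ → ∀ {m} → Vec ℤ m → Set ℓ
  Deg< k       ψ n (h ∷ hs) =
    Deg< k ψ n hs × Deg< k ψ (n ℤ.+ h) hs × Deg< (pred k) (Δ R h ψ) n hs
  Deg< zero    ψ n []       = ψ n ≈ 0#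
  Deg< (suc k) ψ n []       = ⊤

  Deg<-cong : ∀ k {m} (hs : Vec ℤ m) n {ψ χ} → ψ ≗ χ → Deg< k ψ n hs → Deg< k χ n hs
  Deg<-cong zero    []       n ψ≗χ d = trans (sym (ψ≗χ n)) d
  Deg<-cong (suc k) []       n ψ≗χ d = tt
  Deg<-cong k       (h ∷ hs) n ψ≗χ (d₀ , d₁ , dΔ) =
    Deg<-cong k hs n ψ≗χ d₀ , Deg<-cong k hs (n ℤ.+ h) ψ≗χ d₁ ,
    Deg<-cong (pred k) hs n (Δ-cong h ψ≗χ) dΔ

  Deg<-mono : ∀ {k k′} → k ≤ k′ → ∀ {m} (hs : Vec ℤ m) n ψ → Deg< k ψ n hs → Deg< k′ ψ n hs
  Deg<-mono {zero}  {zero}   k≤k′ []       n ψ d = d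
  Deg<-mono {zero}  {suc k′} k≤k′ []       n ψ d = tt
  Deg<-mono {suc k} {suc k′} k≤k′ []       n ψ d = tt
  Deg<-mono k≤k′ (h ∷ hs) n ψ (d₀ , d₁ , dΔ) =
    Deg<-mono k≤k′ hs n ψ d₀ , Deg<-mono k≤k′ hs (n ℤ.+ h) ψ d₁ ,
    Deg<-mono (pred-mono-≤ k≤k′) hs n (Δ R h ψ) dΔ

  Deg<0-Δ : ∀ {m} (hs : Vec ℤ m) n h χ →
            Deg< 0 χ n hs → Deg< 0 χ (n ℤ.+ h) hs → Deg< 0 (Δ R h χ) n hs
  Deg<0-Δ []        n h χ d d′ = trans (+-cong d′ (-‿cong d)) (-‿inverseʳ 0#)
  Deg<0-Δ (h′ ∷ hs) n h χ (d₀ , d₁ , dΔ) (d′₀ , d′₁ , d′Δ) =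
    Deg<0-Δ hs n h χ d₀ d′₀ ,
    Deg<0-Δ hs (n ℤ.+ h′) h χ d₁ (subst (λ n′ → Deg< 0 χ n′ hs) (xy∙z≈xz∙y n h h′) d′₁) ,
    Deg<-cong 0 hs n (Δ-comm h′ h χ) (Deg<0-Δ hs n h (Δ R h′ χ) dΔ d′Δ)

  Deg<-shift : ∀ k {m} (hs : Vec ℤ m) n h g →
               Deg< k g (n ℤ.+ h) hs → Deg< k (λ x → g (x ℤ.+ h)) n hs
  Deg<-shift zero    []        n h g d = d
  Deg<-shift (suc k) []        n h g d = tt
  Deg<-shift k       (h′ ∷ hs) n h g (d₀ , d₁ , dΔ) =
    Deg<-shift k hs n h g d₀ ,
    Deg<-shift k hs (n ℤ.+ h′) h g (subst (λ n′ → Deg< k g n′ hs) (xy∙z≈xz∙y n h h′) d₁) ,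
    Deg<-cong (pred k) hs n (λ x → +-cong (reflexive (≡.cong g (xy∙z≈xz∙y x h h′))) refl)
      (Deg<-shift (pred k) hs n h (Δ R h′ g) dΔ)

  Deg<-+ : ∀ k {m} (hs : Vec ℤ m) n (f g : ℤ → Carrier) →
           Deg< k f n hs → Deg< k g n hs → Deg< k (λ x → f x +ᴿ g x) n hs
  Deg<-+ zero    []       n f g d e = trans (+-cong d e) (+-identityˡ 0#)
  Deg<-+ (suc k) []       n f g d e = tt
  Deg<-+ k       (h ∷ hs) n f g (d₀ , d₁ , dΔ) (e₀ , e₁ , eΔ) =
    Deg<-+ k hs n f g d₀ e₀ , Deg<-+ k hs (n ℤ.+ h) f g d₁ e₁ ,
    Deg<-cong (pred k) hs n (λ x → sym (Δ-+ h f g x)) (Deg<-+ (pred k) hs n (Δ R h f) (Δ R h g) dΔ eΔ)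

  Deg<0-* : ∀ {m} (hs : Vec ℤ m) n (f g : ℤ → Carrier) → Deg< 0 f n hs → Deg< 0 (λ x → f x *ᴿ g x) n hs
  Deg<0-* []       n f g d = trans (*-cong d refl) (zeroˡ _)
  Deg<0-* (h ∷ hs) n f g (d₀ , d₁ , _) =
    fg₀ , fg₁ , Deg<0-Δ hs n h (λ x → f x *ᴿ g x) fg₀ fg₁
    where
    fg₀ : Deg< 0 (λ x → f x *ᴿ g x) n hs
    fg₀ = Deg<0-* hs n f g d₀

    fg₁ : Deg< 0 (λ x → f x *ᴿ g x) (n ℤ.+ h) hs
    fg₁ = Deg<0-* hs (n ℤ.+ h) f g d₁

  Deg<-* : ∀ a b {m} (hs : Vec ℤ m) n (f g : ℤ → Carrier) →
           Deg< a f n hs → Deg< (suc b) g n hs → Deg< (a + b) (λ x → f x *ᴿ g x) n hs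
  Deg<-* zero    b hs       n f g d e = Deg<-mono z≤n hs n _ (Deg<0-* hs n f g d)
  Deg<-* (suc a) b []       n f g d e = tt
  Deg<-* (suc a) b (h ∷ hs) n f g (d₀ , d₁ , dΔ) (e₀ , e₁ , eΔ) =
    Deg<-* (suc a) b hs n f g d₀ e₀ , Deg<-* (suc a) b hs (n ℤ.+ h) f g d₁ e₁ ,
    Deg<-cong (a + b) hs n (λ x → sym (Δ-* h f g x))
      (Deg<-+ (a + b) hs n _ _ Δf·g (subst (λ k → Deg< k f·Δg n hs) (+-comm b a) Δg·f))
    where
    f·Δg : ℤ → Carrier
    f·Δg x = f x *ᴿ Δ R h g x

    Δf·g : Deg< (a + b) (λ x → Δ R h f x *ᴿ g (x ℤ.+ h)) n hs
    Δf·g = Deg<-* a b hs n (Δ R h f) (λ x → g (x ℤ.+ h)) dΔ (Deg<-shift (suc b) hs n h g e₁)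
    Δg·f : Deg< (b + a) f·Δg n hs
    Δg·f = Deg<-cong (b + a) hs n (λ x → *-comm (Δ R h g x) (f x))
             (Deg<-* b a hs n (Δ R h g) f eΔ d₀)

  Deg<-Δs : ∀ {m} (hs : Vec ℤ m) n ψ → Deg< m ψ n hs → Δs R hs ψ n ≈ 0#
  Deg<-Δs []       n ψ d            = d
  Deg<-Δs (h ∷ hs) n ψ (_ , _ , dΔ) =
    trans (sym (Δs-Δ-comm hs h ψ n)) (Deg<-Δs hs n (Δ R h ψ) dΔ)

  module _ {b} (B : ℕ → Set b) {K} {φ : ℕ → Carrier} (lp : LocallyPolynomial R B K φ) where

    LocallyPolynomial⇒Deg<-Δs : ∀ {m} (hs : Vec ℤ m) d {j} (gs : Vec ℤ j) n →
      d + j ≡ suc K → SplitCubeIn B n gs hs → Deg< d (Δs R gs (ext R φ)) n hs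
    LocallyPolynomial⇒Deg<-Δs [] zero gs n ≡.refl cube =
      lp n gs (λ ω → subst (_∈ℤ B) (≡.cong (λ x → n ℤ.+ x) (ℤP.+-identityʳ (ω · gs))) (cube ω []))
    LocallyPolynomial⇒Deg<-Δs [] (suc d) gs n eq cube = tt
    LocallyPolynomial⇒Deg<-Δs (h ∷ hs) d {j} gs n eq cube = face₀ d eq , face₁ d eq , faceΔ d eq
      where
      χ : ℤ → Carrier
      χ = Δs R gs (ext R φ)

      face₀ : ∀ d′ → d′ + j ≡ suc K → Deg< d′ χ n hs
      face₀ d′ eq′ = LocallyPolynomial⇒Deg<-Δs hs d′ gs n eq′ (λ ω ω′ → cube ω (false ∷ ω′))

      face₁ : ∀ d′ → d′ + j ≡ suc K → Deg< d′ χ (n ℤ.+ h) hs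
      face₁ d′ eq′ = LocallyPolynomial⇒Deg<-Δs hs d′ gs (n ℤ.+ h) eq′
        (λ ω ω′ → subst (_∈ℤ B) (shift-vertex n h (ω · gs) (ω′ · hs)) (cube ω (true ∷ ω′)))
        where
        shift-vertex : ∀ (n h x y : ℤ) → n ℤ.+ (x ℤ.+ (h ℤ.+ y)) ≡ (n ℤ.+ h) ℤ.+ (x ℤ.+ y)
        shift-vertex = solve-∀

      -- Once the order suc K is reached, the next difference vanishes because both faces do.
      faceΔ : ∀ d′ → d′ + j ≡ suc K → Deg< (pred d′) (Δ R h χ) n hs
      faceΔ zero     eq′ = Deg<0-Δ hs n h χ (face₀ 0 eq′) (face₁ 0 eq′)
      faceΔ (suc d′) eq′ =
        LocallyPolynomial⇒Deg<-Δs hs d′ (h ∷ gs) n (≡.trans (+-suc d′ j) eq′) cube′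
        where
        move-direction : ∀ (n h x y : ℤ) → n ℤ.+ (x ℤ.+ (h ℤ.+ y)) ≡ n ℤ.+ ((h ℤ.+ x) ℤ.+ y)
        move-direction = solve-∀

        cube′ : SplitCubeIn B n (h ∷ gs) hs
        cube′ (true ∷ ω)  ω′ = subst (_∈ℤ B) (move-direction n h (ω · gs) (ω′ · hs)) (cube ω (true ∷ ω′))
        cube′ (false ∷ ω) ω′ = cube ω (false ∷ ω′)

    LocallyPolynomial⇒Deg< : ∀ n {m} (hs : Vec ℤ m) → CubeIn B n hs → Deg< (suc K) (ext R φ) n hs
    LocallyPolynomial⇒Deg< n hs cube = LocallyPolynomial⇒Deg<-Δs hs (suc K) [] n (+-identityʳ (suc K))
      (λ { [] ω′ → subst (_∈ℤ B) (≡.cong (λ x → n ℤ.+ x) (≡.sym (ℤP.+-identityˡ (ω′ · hs)))) (cube ω′) })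

  Deg<⇒LocallyPolynomial : ∀ {b} (B : ℕ → Set b) K (φ : ℕ → Carrier) →
    (∀ n (hs : Vec ℤ (suc K)) → CubeIn B n hs → Deg< (suc K) (ext R φ) n hs) →
    LocallyPolynomial R B K φ
  Deg<⇒LocallyPolynomial B K φ deg n hs cube = Deg<-Δs hs n (ext R φ) (deg n hs cube)

  module _ {b} {B : ℕ → Set b} {k₁ k₂} {ν₁ ν₂ : ℕ → Carrier}
           (lp₁ : LocallyPolynomial R B k₁ ν₁) (lp₂ : LocallyPolynomial R B k₂ ν₂) where

    LocallyPolynomial-+ : LocallyPolynomial R B (k₁ ⊔ k₂) (λ n → ν₁ n +ᴿ ν₂ n)
    LocallyPolynomial-+ = Deg<⇒LocallyPolynomial B (k₁ ⊔ k₂) _ λ n hs cube →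
      Deg<-cong (suc (k₁ ⊔ k₂)) hs n ext-+ (Deg<-+ _ hs n _ _
        (Deg<-mono (s≤s (m≤m⊔n k₁ k₂)) hs n _ (LocallyPolynomial⇒Deg< B lp₁ n hs cube))
        (Deg<-mono (s≤s (m≤n⊔m k₁ k₂)) hs n _ (LocallyPolynomial⇒Deg< B lp₂ n hs cube)))
      where
      ext-+ : (λ x → ext R ν₁ x +ᴿ ext R ν₂ x) ≗ ext R (λ n → ν₁ n +ᴿ ν₂ n)
      ext-+ (+ n)    = refl
      ext-+ -[1+ n ] = +-identityˡ 0#

    LocallyPolynomial-* : LocallyPolynomial R B (k₁ + k₂) (λ n → ν₁ n *ᴿ ν₂ n)
    LocallyPolynomial-* = Deg<⇒LocallyPolynomial B (k₁ + k₂) _ λ n hs cube →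
      Deg<-cong (suc (k₁ + k₂)) hs n ext-* (Deg<-* (suc k₁) k₂ hs n _ _
        (LocallyPolynomial⇒Deg< B lp₁ n hs cube)
        (LocallyPolynomial⇒Deg< B lp₂ n hs cube))
      where
      ext-* : (λ x → ext R ν₁ x *ᴿ ext R ν₂ x) ≗ ext R (λ n → ν₁ n *ᴿ ν₂ n)
      ext-* (+ n)    = refl
      ext-* -[1+ n ] = zeroˡ 0#

lemma3p6 : ∀ {c ℓ b} (R : CommutativeRing c ℓ) (B : ℕ → Set b)
             (ν₁ ν₂ : ℕ → CommutativeRing.Carrier R) (k₁ k₂ : ℕ) →
             LocallyPolynomial R B k₁ ν₁ → LocallyPolynomial R B k₂ ν₂ →
             LocallyPolynomial R B (k₁ ⊔ k₂) (λ n → CommutativeRing._+_ R (ν₁ n) (ν₂ n))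
             × LocallyPolynomial R B (k₁ + k₂) (λ n → CommutativeRing._*_ R (ν₁ n) (ν₂ n))
lemma3p6 R B ν₁ ν₂ k₁ k₂ lp₁ lp₂ = LocallyPolynomial-+ R lp₁ lp₂ , LocallyPolynomial-* R lp₁ lp₂
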